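{- Let $\mathcal{B}^{\mathsf{p}}=\{\max,\mathsf{E},\mathsf{div}_q\mid q\text{ a prime}\}$. For every prime $p$, we have $\mathsf{div}_p\notin(\mathcal{B}^{\mathsf{p}}\setminus\{\mathsf{div}_p\})^\circ$.
   Context: $\max(x,y)$ is the maximum; $\mathsf{E}(x,y)=y$ if $x=0$ and $0$ otherwise; $\mathsf{div}_m(x)=\lfloor x/m\rfloor$. For a set $F$ of functions, $F^\circ$ is the set of all functions computed by circuits whose gates compute either affine functions with integer coefficients of their inputs or functions from $F$. -}

module Defs where

open import Data.Nat using (ℕ; NonZero)
open import Data.Nat.Primality using (Prime; prime⇒nonZero)
open import Data.Integer using (ℤ; +_; _+_; _*_; _/ℕ_)
open import Data.Integer.Properties using (_≟_)
open import Data.Fin using (Fin; zero; suc)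
open import Data.Unit using (⊤)
open import Data.Product using (Σ; proj₁)
open import Relation.Nullary using (¬_; yes; no)
open import Relation.Binary.PropositionalEquality using (_≡_)

maxℤ : ℤ → ℤ → ℤ
maxℤ = Data.Integer._⊔_
  where import Data.Integer

E : ℤ → ℤ → ℤ
E x y with x ≟ + 0
... | yes _ = y
... | no  _ = + 0

-- div_m(x) = ⌊x/m⌋  (floor division; _/ℕ_ has nonnegative remainder)
div : (m : ℕ) → .{{NonZero m}} → ℤ → ℤ
div m x = x /ℕ m

-- A set F of functions, presented as a family of gate symbols,
-- each with an arity and the function ℤ^arity → ℤ it computes.

record Basis : Set₁ where
  field
    Gate  : Set
    arity : Gate → ℕ
    sem   : (g : Gate) → (Fin (arity g) → ℤ) → ℤ

open Basis

∑ : (k : ℕ) → (Fin k → ℤ) → ℤ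
∑ ℕ.zero    f = + 0
∑ (ℕ.suc k) f = f zero + ∑ k (λ i → f (suc i))

-- Gates are: input variables,
-- affine functions with integer coefficients of their inputs
-- (b + Σ a_j y_j), or gates from F.  (Circuits are represented as
-- formulas/trees; unfolding a DAG into a tree computes the same function.)
data Circuit (F : Basis) (n : ℕ) : Set where
  input  : Fin n → Circuit F n
  affine : (k : ℕ) → (a : Fin k → ℤ) → (b : ℤ) → (Fin k → Circuit F n) → Circuit F n
  gate   : (g : Gate F) → (Fin (arity F g) → Circuit F n) → Circuit F n

eval : {F : Basis} {n : ℕ} → Circuit F n → (Fin n → ℤ) → ℤ
eval (input i)        x = x i
eval (affine k a b c) x = b + ∑ k (λ j → a j * eval (c j) x)
eval {F} (gate g c)   x = sem F g (λ j → eval (c j) x)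

_∈°_ : {n : ℕ} → ((Fin n → ℤ) → ℤ) → Basis → Set
_∈°_ {n} f F = Σ (Circuit F n) (λ C → ∀ x → eval C x ≡ f x)

data BGate : Set where
  maxG : BGate
  EG   : BGate
  divG : (q : ℕ) → Prime q → BGate

BArity : BGate → ℕ
BArity maxG       = 2
BArity EG         = 2
BArity (divG _ _) = 1

BSem : (g : BGate) → (Fin (BArity g) → ℤ) → ℤ
BSem maxG         y = maxℤ (y zero) (y (suc zero))
BSem EG           y = E (y zero) (y (suc zero))
BSem (divG q pq)  y = div q {{prime⇒nonZero pq}} (y zero)

NotDiv : ℕ → BGate → Set
NotDiv p maxG       = ⊤
NotDiv p EG         = ⊤
NotDiv p (divG q _) = ¬ (q ≡ p)

BpWithout : ℕ → Basis
BpWithout p = record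
  { Gate  = Σ BGate (NotDiv p)
  ; arity = λ g → BArity (proj₁ g)
  ; sem   = λ g → BSem (proj₁ g)
  }

divFun : (p : ℕ) → .{{NonZero p}} → (Fin 1 → ℤ) → ℤ
divFun p x = div p (x zero)

{-# OPTIONS --safe #-}
module Submission where

-- Follow a unary function f along a ray j ↦ jM with p ∤ M.  If f is computed without
-- div_p, then j ↦ f(jM) is eventually an arithmetic progression in j: affine gates
-- preserve this outright; max and E only depend on the eventual sign of a progression,
-- which is constant; and div_q maps a progression of slope q·d sampled at multiples of q
-- to one of slope d, so it preserves the property once the ray is refined to j ↦ jqM,
-- which for q ≠ p still avoids multiples of p.  But j ↦ ⌊jM/p⌋ grows by M every p
-- steps, so if it were eventually a progression with slope d, then M = pd.

open import Defs
open import Data.Nat using (ℕ)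
open import Data.Nat.Primality using (Prime; prime⇒nonZero)
open import Relation.Nullary using (¬_)

import Data.Nat as ℕ
import Data.Nat.Properties as ℕₚ
open import Data.Nat.Divisibility using (_∣_; divides; ∣1⇒≡1)
open import Data.Nat.Primality using (euclidsLemma; prime⇒irreducible; ¬prime[1])
open import Data.Integer
  using (ℤ; +_; -[1+_]; +[1+_]; 0ℤ; -1ℤ; _+_; _*_; -_; _≤_; _<_; _⊔_; ∣_∣; _/ℕ_; +<+)
  renaming (suc to sucℤ)
open import Data.Integer.Properties
open import Data.Integer.DivMod using ([n/ℕd]*d≤n; n<s[n/ℕd]*d)
open import Data.Integer.Tactic.RingSolver using (solve-∀)
open import Algebra.Properties.AbelianGroup +-0-abelianGroup using (∙-cancelˡ)
open import Data.Fin using (Fin; zero; suc)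
open import Data.Product using (∃₂; _,_)
open import Data.Sum using (inj₁; inj₂)
open import Function using (_∘_)
open import Relation.Nullary using (yes; no; contradiction)
open import Relation.Binary.Definitions using (tri<; tri≈; tri>)
open import Relation.Binary.PropositionalEquality

i<suc[j]⇒i≤j : ∀ {i j} → i < sucℤ j → i ≤ j
i<suc[j]⇒i≤j {i} {j} i<sj = subst₂ _≤_ (pred-suc i) (pred-suc j) (pred-mono (i<j⇒suc[i]≤j i<sj))

/ℕ-unique : ∀ n d .{{_ : ℕ.NonZero d}} {q} → q * + d ≤ n → n < sucℤ q * + d → n /ℕ d ≡ q
/ℕ-unique n d lower upper = ≤-antisym
  (i<suc[j]⇒i≤j (*-cancelʳ-<-nonNeg (+ d) (≤-<-trans ([n/ℕd]*d≤n n d) upper)))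
  (i<suc[j]⇒i≤j (*-cancelʳ-<-nonNeg (+ d) (≤-<-trans lower (n<s[n/ℕd]*d n d))))

[n+k*d]/ℕd≡n/ℕd+k : ∀ n k d .{{_ : ℕ.NonZero d}} → (n + k * + d) /ℕ d ≡ n /ℕ d + k
[n+k*d]/ℕd≡n/ℕd+k n k d = /ℕ-unique (n + k * + d) d lower upper
  where
  q = n /ℕ d
  lower : (q + k) * + d ≤ n + k * + d
  lower = subst (_≤ n + k * + d) (sym (*-distribʳ-+ (+ d) q k))
                (+-monoˡ-≤ (k * + d) ([n/ℕd]*d≤n n d))
  shift : ∀ q k d → (+ 1 + q) * d + k * d ≡ (+ 1 + (q + k)) * d
  shift = solve-∀
  upper : n + k * + d < sucℤ (q + k) * + d
  upper = subst (n + k * + d <_) (shift q k (+ d)) (+-monoˡ-< (k * + d) (n<s[n/ℕd]*d n d))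

record Eventually (P : ℕ → Set) : Set where
  constructor from
  field
    threshold : ℕ
    holds     : ∀ j → threshold ℕ.≤ j → P j

always : ∀ {P} → (∀ j → P j) → Eventually P
always p = from 0 (λ j _ → p j)

eventually-map : ∀ {P Q} → (∀ {j} → P j → Q j) → Eventually P → Eventually Q
eventually-map f (from J p) = from J (λ j J≤j → f (p j J≤j))

eventually-zipWith : ∀ {P Q R} → (∀ {j} → P j → Q j → R j) →
                     Eventually P → Eventually Q → Eventually R
eventually-zipWith f (from J p) (from K q) = from (J ℕ.⊔ K) λ j J⊔K≤j →
  f (p j (ℕₚ.m⊔n≤o⇒m≤o J K J⊔K≤j)) (q j (ℕₚ.m⊔n≤o⇒n≤o J K J⊔K≤j))

eventually-∘* : ∀ {P} k .{{_ : ℕ.NonZero k}} → Eventually P → Eventually (P ∘ (ℕ._* k))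
eventually-∘* k (from J p) =
  from J (λ j J≤j → p (j ℕ.* k) (ℕₚ.≤-trans J≤j (ℕₚ.m≤m*n j k)))

infix 4 _≈ᵉ_

_≈ᵉ_ : (ℕ → ℤ) → (ℕ → ℤ) → Set
s ≈ᵉ t = Eventually (λ j → s j ≡ t j)

≈ᵉ-sym : ∀ {s t} → s ≈ᵉ t → t ≈ᵉ s
≈ᵉ-sym = eventually-map sym

≈ᵉ-trans : ∀ {s t u} → s ≈ᵉ t → t ≈ᵉ u → s ≈ᵉ u
≈ᵉ-trans = eventually-zipWith trans

progression : ℤ → ℤ → ℕ → ℤ
progression a d j = a + + j * d

EventuallyArithmetic : (ℕ → ℤ) → Set
EventuallyArithmetic s = ∃₂ λ a d → s ≈ᵉ progression a d

progression-flat : ∀ a j → progression a 0ℤ j ≡ a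
progression-flat a j = trans (cong (λ x → a + x) (*-zeroʳ (+ j))) (+-identityʳ a)

progression-+ : ∀ a d b e j → progression a d j + progression b e j ≡ progression (a + b) (d + e) j
progression-+ a d b e j = ring a d b e (+ j)
  where
  ring : ∀ a d b e x → a + x * d + (b + x * e) ≡ a + b + x * (d + e)
  ring = solve-∀

progression-*ˡ : ∀ c a d j → c * progression a d j ≡ progression (c * a) (c * d) j
progression-*ˡ c a d j = ring c a d (+ j)
  where
  ring : ∀ c a d x → c * (a + x * d) ≡ c * a + x * (c * d)
  ring = solve-∀

neg-progression : ∀ a d j → - progression (- a) d j ≡ progression a (- d) j
neg-progression a d j = ring a d (+ j)
  where
  ring : ∀ a d x → - (- a + x * d) ≡ a + x * (- d)
  ring = solve-∀

progression-∘* : ∀ a d j k → progression a d (j ℕ.* k) ≡ progression a (+ k * d) j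
progression-∘* a d j k = trans (cong (λ x → a + x * d) (pos-* j k)) (ring a d (+ j) (+ k))
  where
  ring : ∀ a d x y → a + x * y * d ≡ a + x * (y * d)
  ring = solve-∀

progression-shift : ∀ a d j k → progression a d (j ℕ.+ k) ≡ progression a d j + + k * d
progression-shift a d j k = trans (cong (λ x → a + x * d) (pos-+ j k)) (ring a d (+ j) (+ k))
  where
  ring : ∀ a d x y → a + (x + y) * d ≡ a + x * d + y * d
  ring = solve-∀

progression-/ℕ : ∀ a d j q .{{_ : ℕ.NonZero q}} →
                 progression a (+ q * d) j /ℕ q ≡ progression (a /ℕ q) d j
progression-/ℕ a d j q =
  trans (cong (_/ℕ q) (ring a d (+ j) (+ q))) ([n+k*d]/ℕd≡n/ℕd+k a (+ j * d) q)
  where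
  ring : ∀ a d x y → a + x * (y * d) ≡ a + x * d * y
  ring = solve-∀

arithmetic-resp : ∀ {s t} → s ≈ᵉ t → EventuallyArithmetic s → EventuallyArithmetic t
arithmetic-resp s≈t (a , d , s≈a+jd) = a , d , ≈ᵉ-trans (≈ᵉ-sym s≈t) s≈a+jd

arithmetic-const : ∀ c → EventuallyArithmetic (λ _ → c)
arithmetic-const c = c , 0ℤ , always (λ j → sym (progression-flat c j))

arithmetic-+ : ∀ {s t} → EventuallyArithmetic s → EventuallyArithmetic t →
               EventuallyArithmetic (λ j → s j + t j)
arithmetic-+ (a , d , s≈) (b , e , t≈) = a + b , d + e ,
  eventually-zipWith (λ {j} s≡ t≡ → trans (cong₂ _+_ s≡ t≡) (progression-+ a d b e j)) s≈ t≈

arithmetic-*ˡ : ∀ {s} c → EventuallyArithmetic s → EventuallyArithmetic (λ j → c * s j)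
arithmetic-*ˡ c (a , d , s≈) = c * a , c * d ,
  eventually-map (λ {j} s≡ → trans (cong (c *_) s≡) (progression-*ˡ c a d j)) s≈

arithmetic-neg : ∀ {s} → EventuallyArithmetic s → EventuallyArithmetic (λ j → - s j)
arithmetic-neg {s} = arithmetic-resp (always (λ j → -1*i≡-i (s j))) ∘ arithmetic-*ˡ -1ℤ

arithmetic-∘* : ∀ {s} k → EventuallyArithmetic s → EventuallyArithmetic (s ∘ (ℕ._* k))
arithmetic-∘* {s} ℕ.zero _ =
  arithmetic-resp (always (λ j → cong s (sym (ℕₚ.*-zeroʳ j)))) (arithmetic-const (s 0))
arithmetic-∘* k@(ℕ.suc _) (a , d , s≈) = a , + k * d ,
  eventually-map (λ {j} s≡ → trans s≡ (progression-∘* a d j k)) (eventually-∘* k s≈)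

arithmetic-/ℕ : ∀ {s} q .{{_ : ℕ.NonZero q}} → EventuallyArithmetic s →
                EventuallyArithmetic (λ j → s (j ℕ.* q) /ℕ q)
arithmetic-/ℕ q (a , d , s≈) = a /ℕ q , d ,
  eventually-map (λ {j} s≡ → trans (cong (_/ℕ q) (trans s≡ (progression-∘* a d j q)))
                                   (progression-/ℕ a d j q))
                 (eventually-∘* q s≈)

data EventualSign (u : ℕ → ℤ) : Set where
  eventually-zero     : Eventually (λ j → u j ≡ 0ℤ) → EventualSign u
  eventually-positive : Eventually (λ j → 0ℤ < u j) → EventualSign u
  eventually-negative : Eventually (λ j → u j < 0ℤ) → EventualSign u

eventualSign-resp : ∀ {u v} → u ≈ᵉ v → EventualSign v → EventualSign u
eventualSign-resp u≈v (eventually-zero v≡0) =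
  eventually-zero (eventually-zipWith (λ u≡v v≡0 → trans u≡v v≡0) u≈v v≡0)
eventualSign-resp u≈v (eventually-positive 0<v) =
  eventually-positive (eventually-zipWith (λ u≡v 0<v → subst (0ℤ <_) (sym u≡v) 0<v) u≈v 0<v)
eventualSign-resp u≈v (eventually-negative v<0) =
  eventually-negative (eventually-zipWith (λ u≡v v<0 → subst (_< 0ℤ) (sym u≡v) v<0) u≈v v<0)

∣i∣<m⇒0<i+m : ∀ i m → ∣ i ∣ ℕ.< m → 0ℤ < i + + m
∣i∣<m⇒0<i+m (+ n)    m ∣i∣<m = +<+ (ℕₚ.<-≤-trans (ℕₚ.≤-<-trans ℕ.z≤n ∣i∣<m) (ℕₚ.m≤n+m m n))
∣i∣<m⇒0<i+m -[1+ n ] m ∣i∣<m =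
  subst (0ℤ <_) (sym (⊖-≥ (ℕₚ.<⇒≤ ∣i∣<m))) (+<+ (ℕₚ.m<n⇒0<n∸m ∣i∣<m))

-- Beyond j = |a| the slope dominates the offset.
0<progression : ∀ a n j → ∣ a ∣ ℕ.< j → 0ℤ < progression a +[1+ n ] j
0<progression a n j ∣a∣<j = subst (λ x → 0ℤ < a + x) (pos-* j (ℕ.suc n))
  (∣i∣<m⇒0<i+m a (j ℕ.* ℕ.suc n) (ℕₚ.<-≤-trans ∣a∣<j (ℕₚ.m≤m*n j (ℕ.suc n))))

progression-sign : ∀ a d → EventualSign (progression a d)
progression-sign a +[1+ n ] = eventually-positive (from (ℕ.suc ∣ a ∣) (0<progression a n))
progression-sign a -[1+ n ] = eventually-negative (from (ℕ.suc ∣ a ∣) λ j ∣a∣<j →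
  subst (_< 0ℤ) (neg-progression a +[1+ n ] j)
        (neg-mono-< (0<progression (- a) n j (subst (ℕ._< j) (sym (∣-i∣≡∣i∣ a)) ∣a∣<j))))
progression-sign a (+ 0) with <-cmp a 0ℤ
... | tri< a<0 _ _ = eventually-negative (always λ j → subst (_< 0ℤ) (sym (progression-flat a j)) a<0)
... | tri≈ _ a≡0 _ = eventually-zero     (always λ j → trans (progression-flat a j) a≡0)
... | tri> _ _ 0<a = eventually-positive (always λ j → subst (0ℤ <_) (sym (progression-flat a j)) 0<a)

arithmetic⇒eventualSign : ∀ {u} → EventuallyArithmetic u → EventualSign u
arithmetic⇒eventualSign (a , d , u≈) = eventualSign-resp u≈ (progression-sign a d)

arithmetic-⊔ : ∀ {s t} → EventuallyArithmetic s → EventuallyArithmetic t →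
               EventuallyArithmetic (λ j → s j ⊔ t j)
arithmetic-⊔ s-arith t-arith
  with arithmetic⇒eventualSign (arithmetic-+ s-arith (arithmetic-neg t-arith))
... | eventually-zero s-t≡0 = arithmetic-resp
  (eventually-map (λ s-t≡0 → sym (i≥j⇒i⊔j≡i (0≤i-j⇒j≤i (≤-reflexive (sym s-t≡0))))) s-t≡0) s-arith
... | eventually-positive 0<s-t = arithmetic-resp
  (eventually-map (λ 0<s-t → sym (i≥j⇒i⊔j≡i (0≤i-j⇒j≤i (<⇒≤ 0<s-t)))) 0<s-t) s-arith
... | eventually-negative s-t<0 = arithmetic-resp
  (eventually-map (λ s-t<0 → sym (i≤j⇒i⊔j≡j (i-j≤0⇒i≤j (<⇒≤ s-t<0)))) s-t<0) t-arith

E-≢0 : ∀ {x} y → x ≢ 0ℤ → E x y ≡ 0ℤ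
E-≢0 {x} y x≢0 with x ≟ 0ℤ
... | yes x≡0 = contradiction x≡0 x≢0
... | no _    = refl

arithmetic-E : ∀ {u t} → EventuallyArithmetic u → EventuallyArithmetic t →
               EventuallyArithmetic (λ j → E (u j) (t j))
arithmetic-E {t = t} u-arith t-arith with arithmetic⇒eventualSign u-arith
... | eventually-zero u≡0 =
  arithmetic-resp (eventually-map (λ {j} u≡0 → cong (λ x → E x (t j)) (sym u≡0)) u≡0) t-arith
... | eventually-positive 0<u = arithmetic-resp
  (eventually-map (λ {j} 0<u → sym (E-≢0 (t j) (λ u≡0 → <-irrefl (sym u≡0) 0<u))) 0<u)
  (arithmetic-const 0ℤ)
... | eventually-negative u<0 = arithmetic-resp
  (eventually-map (λ {j} u<0 → sym (E-≢0 (t j) (λ u≡0 → <-irrefl u≡0 u<0))) u<0)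
  (arithmetic-const 0ℤ)

arithmetic-[j*M]/ℕp⇒p∣M : ∀ p .{{_ : ℕ.NonZero p}} M →
                          EventuallyArithmetic (λ j → + (j ℕ.* M) /ℕ p) → p ∣ M
arithmetic-[j*M]/ℕp⇒p∣M p M (a , d , from J agrees) =
  divides ∣ d ∣ (trans (cong ∣_∣ M≡p*d) (trans (abs-* (+ p) d) (ℕₚ.*-comm p ∣ d ∣)))
  where
  s : ℕ → ℤ
  s j = + (j ℕ.* M) /ℕ p
  step : s (J ℕ.+ p) ≡ s J + + M
  step = trans (cong (_/ℕ p) split) ([n+k*d]/ℕd≡n/ℕd+k (+ (J ℕ.* M)) (+ M) p)
    where
    split : + ((J ℕ.+ p) ℕ.* M) ≡ + (J ℕ.* M) + + M * + p
    split = begin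
      + ((J ℕ.+ p) ℕ.* M)       ≡⟨ cong +_ (ℕₚ.*-distribʳ-+ M J p) ⟩
      + (J ℕ.* M ℕ.+ p ℕ.* M)   ≡⟨ cong (λ n → + (J ℕ.* M ℕ.+ n)) (ℕₚ.*-comm p M) ⟩
      + (J ℕ.* M ℕ.+ M ℕ.* p)   ≡⟨ pos-+ (J ℕ.* M) (M ℕ.* p) ⟩
      + (J ℕ.* M) + + (M ℕ.* p) ≡⟨ cong (λ x → + (J ℕ.* M) + x) (pos-* M p) ⟩
      + (J ℕ.* M) + + M * + p   ∎
      where open ≡-Reasoning
  M≡p*d : + M ≡ + p * d
  M≡p*d = ∙-cancelˡ (s J) (+ M) (+ p * d) (begin
    s J + + M                   ≡⟨ step ⟨
    s (J ℕ.+ p)                 ≡⟨ agrees (J ℕ.+ p) (ℕₚ.m≤m+n J p) ⟩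
    progression a d (J ℕ.+ p)   ≡⟨ progression-shift a d J p ⟩
    progression a d J + + p * d ≡⟨ cong (_+ + p * d) (agrees J ℕₚ.≤-refl) ⟨
    s J + + p * d               ∎)
    where open ≡-Reasoning

onRay : ((Fin 1 → ℤ) → ℤ) → ℕ → ℕ → ℤ
onRay f M j = f (λ _ → + (j ℕ.* M))

record Tame (p : ℕ) (f : (Fin 1 → ℤ) → ℤ) : Set where
  constructor tame
  field
    ray        : ℕ
    p∤ray      : ¬ p ∣ ray
    arithmetic : EventuallyArithmetic (onRay f ray)

onRay-refine : ∀ f M k → EventuallyArithmetic (onRay f M) →
               EventuallyArithmetic (onRay f (k ℕ.* M))
onRay-refine f M k =
  arithmetic-resp (always λ j → cong (λ n → f (λ _ → + n)) (ℕₚ.*-assoc j k M)) ∘ arithmetic-∘* k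

tame-resp : ∀ {p f g} → (∀ x → f x ≡ g x) → Tame p f → Tame p g
tame-resp f≗g (tame M p∤M f-arith) = tame M p∤M (arithmetic-resp (always λ _ → f≗g _) f-arith)

divFun-untame : ∀ p .{{_ : ℕ.NonZero p}} → ¬ Tame p (divFun p)
divFun-untame p (tame M p∤M arith) = p∤M (arithmetic-[j*M]/ℕp⇒p∣M p M arith)

module _ {p : ℕ} (p-prime : Prime p) where

  p≢1 : p ≢ 1
  p≢1 p≡1 = ¬prime[1] (subst Prime p≡1 p-prime)

  p∤1 : ¬ p ∣ 1
  p∤1 = p≢1 ∘ ∣1⇒≡1

  p∤m⇒p∤n⇒p∤m*n : ∀ {m n} → ¬ p ∣ m → ¬ p ∣ n → ¬ p ∣ m ℕ.* n
  p∤m⇒p∤n⇒p∤m*n {m} {n} p∤m p∤n p∣mn with euclidsLemma m n p-prime p∣mn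
  ... | inj₁ p∣m = p∤m p∣m
  ... | inj₂ p∣n = p∤n p∣n

  p∤prime : ∀ {q} → Prime q → q ≢ p → ¬ p ∣ q
  p∤prime q-prime q≢p p∣q with prime⇒irreducible q-prime p∣q
  ... | inj₁ p≡1 = p≢1 p≡1
  ... | inj₂ p≡q = q≢p (sym p≡q)

  tame-const : ∀ c → Tame p (λ _ → c)
  tame-const c = tame 1 p∤1 (arithmetic-const c)

  tame-input : Tame p (λ x → x zero)
  tame-input = tame 1 p∤1 (0ℤ , + 1 , always λ j →
    trans (cong +_ (ℕₚ.*-identityʳ j)) (sym (trans (+-identityˡ (+ j * + 1)) (*-identityʳ (+ j)))))

  tame-*ˡ : ∀ {f} c → Tame p f → Tame p (λ x → c * f x)
  tame-*ˡ c (tame M p∤M f-arith) = tame M p∤M (arithmetic-*ˡ c f-arith)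

  tame-/ℕ : ∀ {f} q .{{_ : ℕ.NonZero q}} → ¬ p ∣ q → Tame p f → Tame p (λ x → f x /ℕ q)
  tame-/ℕ {f} q p∤q (tame M p∤M f-arith) = tame (q ℕ.* M) (p∤m⇒p∤n⇒p∤m*n p∤q p∤M)
    (arithmetic-resp (always λ j → cong (λ n → f (λ _ → + n) /ℕ q) (ℕₚ.*-assoc j q M))
                     (arithmetic-/ℕ q f-arith))

  tame-zipWith : ∀ {f g} (_∙_ : ℤ → ℤ → ℤ) →
                 (∀ {s t} → EventuallyArithmetic s → EventuallyArithmetic t →
                            EventuallyArithmetic (λ j → s j ∙ t j)) →
                 Tame p f → Tame p g → Tame p (λ x → f x ∙ g x)
  tame-zipWith {f} {g} _∙_ arithmetic-∙ (tame M p∤M f-arith) (tame N p∤N g-arith) =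
    tame (N ℕ.* M) (p∤m⇒p∤n⇒p∤m*n p∤N p∤M)
      (arithmetic-∙ (onRay-refine f M N f-arith)
                    (subst (EventuallyArithmetic ∘ onRay g) (ℕₚ.*-comm M N) (onRay-refine g N M g-arith)))

  tame-∑ : ∀ k {f : Fin k → (Fin 1 → ℤ) → ℤ} → (∀ i → Tame p (f i)) →
           Tame p (λ x → ∑ k (λ i → f i x))
  tame-∑ ℕ.zero    _      = tame-const 0ℤ
  tame-∑ (ℕ.suc k) f-tame = tame-zipWith _+_ arithmetic-+ (f-tame zero) (tame-∑ k (f-tame ∘ suc))

  eval-tame : (C : Circuit (BpWithout p) 1) → Tame p (eval C)
  eval-tame (input zero) = tame-input
  eval-tame (affine k a b c) =
    tame-zipWith _+_ arithmetic-+ (tame-const b)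
                 (tame-∑ k (λ i → tame-*ˡ (a i) (eval-tame (c i))))
  eval-tame (gate (maxG , _) c) =
    tame-zipWith _⊔_ arithmetic-⊔ (eval-tame (c zero)) (eval-tame (c (suc zero)))
  eval-tame (gate (EG , _) c) =
    tame-zipWith E arithmetic-E (eval-tame (c zero)) (eval-tame (c (suc zero)))
  eval-tame (gate (divG q q-prime , q≢p) c) =
    tame-/ℕ q {{prime⇒nonZero q-prime}} (p∤prime q-prime q≢p) (eval-tame (c zero))

mainTheorem12 : (p : ℕ) → (pp : Prime p) →
    ¬ (_∈°_ (divFun p {{prime⇒nonZero pp}}) (BpWithout p))
mainTheorem12 p pp (C , C≗divₚ) =
  divFun-untame p {{prime⇒nonZero pp}} (tame-resp C≗divₚ (eval-tame pp C))
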